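{- For every $t\in P^*$, the tiling $W_t$ is nonperiodic: there is no integer $m>0$ such that $W_t(n+m)=W_t(n)$ for all $n\in\mathbb{N}$.
   Context: Let $p$ be an odd prime and $\mathbb{F}_p$ the field with $p$ elements. A tile $\square(x,y)$ is a unit segment whose left and right endpoints are decorated with $x,y\in\mathbb{F}_p$; $P$ is the set of such tiles and $P^*=P\setminus\{\square(0,0)\}$. The substitution $\tau$ maps $\square(x,y)$ to the sequence $\square(x,x+y)\,\square(x+y,y)$ and acts on sequences of tiles by concatenating images. For $t\in P$, $\tau^p(t)$ begins with $t$, so each $\tau^{kp}(t)$ is a prefix of $\tau^{(k+1)p}(t)$; $W_t$ is the infinite sequence of tiles (a tiling of the half-line) that is the limit of $\tau^{kp}(t)$ as $k\to\infty$, and $W_t(n)$ denotes its $n$-th tile ($n\ge 0$). -}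

module Defs where

open import Data.Nat using (ℕ; zero; suc; _*_; NonZero; _%_)
open import Data.Nat.DivMod using (m%n<n)
open import Data.Fin using (Fin; toℕ; fromℕ<)
open import Data.Product using (_×_; _,_)
open import Data.List using (List; []; _∷_; concatMap)

module _ (p : ℕ) .{{_ : NonZero p}} where

  𝔽 : Set
  𝔽 = Fin p

  𝟘 : 𝔽
  𝟘 = fromℕ< (m%n<n 0 p)

  _⊕_ : 𝔽 → 𝔽 → 𝔽
  x ⊕ y = fromℕ< (m%n<n (toℕ x Data.Nat.+ toℕ y) p)

  -- A tile □(x,y): left decoration x, right decoration y.
  Tile : Set
  Tile = 𝔽 × 𝔽

  τ₁ : Tile → List Tile
  τ₁ (x , y) = (x , x ⊕ y) ∷ (x ⊕ y , y) ∷ []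

  τ : List Tile → List Tile
  τ = concatMap τ₁

  τ^ : ℕ → List Tile → List Tile
  τ^ zero ws = ws
  τ^ (suc k) ws = τ (τ^ k ws)

  nth : Tile → List Tile → ℕ → Tile
  nth d [] n = d
  nth d (w ∷ ws) zero = w
  nth d (w ∷ ws) (suc n) = nth d ws n

  -- W_t(n): the n-th tile of the limit of τ^{kp}(t).  Since τ^{kp}(t) is a
  -- prefix of τ^{(k+1)p}(t) and has length 2^{kp} > n as soon as k ≥ n+1,
  -- W_t(n) is the n-th tile of τ^{(n+1)p}(t).
  W : Tile → ℕ → Tile
  W t n = nth t (τ^ (suc n * p) (t ∷ [])) n

-- Write Wⱼ for τʲ(W_t): then W_{j+p} = W_j, W_{j+1} = τ(W_j), and adjacent tiles of
-- each Wⱼ match.  A period 2m of τ(w) halves to a period m of w, so an even period of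
-- W₀ = W_p = τ(W_{p-1}) yields the period m of W_{p-1} and hence of W₀.  An odd period
-- of τ(w) forces the left decorations c of w to satisfy c(n) + c(n+1) + c(n+2) = 0 and,
-- 2 being invertible in 𝔽_p, w(0) = □(0,0); for w = W_{p-1} this gives
-- t = W_p(0) = τ(□(0,0))(0) = □(0,0).  Descent on the period concludes.

module Submission where

open import Defs
open import Data.Nat
  using (ℕ; zero; suc; _+_; _*_; _^_; _∸_; _%_; _<_; _≤_; s≤s; z≤n; z<s; NonZero; nonTrivial⇒n>1; >-nonZero⁻¹)
open import Data.Nat.Properties
open import Data.Nat.DivMod using (m%n<n; m<n⇒m%n≡m; n%n≡0; %-distribˡ-+; m%n%n≡m%n; [m+kn]%n≡m%n)
open import Data.Nat.Divisibility using (_∣_; ∣⇒≤; ∣-refl; m%n≡0⇒n∣m; n∣m⇒m%n≡0)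
open import Data.Nat.Primality using (Prime; euclidsLemma; prime⇒nonTrivial; prime⇒nonZero)
open import Data.Nat.GeneralisedArithmetic using (fold)
open import Data.Nat.Induction using (<-wellFounded)
open import Data.Nat.Tactic.RingSolver using (solve-∀)
open import Data.Fin using (toℕ; fromℕ<)
open import Data.Fin.Properties using (toℕ-fromℕ<; toℕ-injective; toℕ<n)
open import Data.List using ([]; _∷_; _++_; length)
open import Data.List.Properties using (concatMap-++)
open import Data.List.Relation.Unary.Linked using (Linked; []; [-]; _∷_)
open import Data.Product using (Σ; ∃; _×_; _,_; proj₁; proj₂)
open import Data.Sum using (inj₁; inj₂)
open import Data.Empty using (⊥-elim)
open import Function using (_∘_)
open import Induction.WellFounded using (Acc; acc)
open import Relation.Nullary using (¬_)
open import Relation.Binary.PropositionalEquality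
  using (_≡_; refl; sym; trans; cong; cong₂; subst; subst₂; module ≡-Reasoning)

[m%d+n]%d≡[m+n]%d : ∀ m n d .{{_ : NonZero d}} → (m % d + n) % d ≡ (m + n) % d
[m%d+n]%d≡[m+n]%d m n d = begin
  (m % d + n) % d            ≡⟨ %-distribˡ-+ (m % d) n d ⟩
  (m % d % d + n % d) % d    ≡⟨ cong (λ k → (k + n % d) % d) (m%n%n≡m%n m d) ⟩
  (m % d + n % d) % d        ≡⟨ sym (%-distribˡ-+ m n d) ⟩
  (m + n) % d                ∎
  where open ≡-Reasoning

[m+n%d]%d≡[m+n]%d : ∀ m n d .{{_ : NonZero d}} → (m + n % d) % d ≡ (m + n) % d
[m+n%d]%d≡[m+n]%d m n d = begin
  (m + n % d) % d  ≡⟨ cong (_% d) (+-comm m (n % d)) ⟩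
  (n % d + m) % d  ≡⟨ [m%d+n]%d≡[m+n]%d n m d ⟩
  (n + m) % d      ≡⟨ cong (_% d) (+-comm n m) ⟩
  (m + n) % d      ∎
  where open ≡-Reasoning

n<2^n : ∀ n → n < 2 ^ n
n<2^n zero    = s≤s z≤n
n<2^n (suc n) = +-mono-≤ (m^n>0 2 n) (subst (suc n ≤_) (sym (+-identityʳ (2 ^ n))) (n<2^n n))

data EvenOrOdd : ℕ → Set where
  even : ∀ k → EvenOrOdd (2 * k)
  odd  : ∀ k → EvenOrOdd (suc (2 * k))

evenOrOdd : ∀ n → EvenOrOdd n
evenOrOdd zero = even zero
evenOrOdd (suc n) with evenOrOdd n
... | even k = odd k
... | odd k  = subst EvenOrOdd (*-suc 2 k) (even (suc k))

Periodic : {A : Set} → (ℕ → A) → ℕ → Set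
Periodic f m = ∀ n → f (n + m) ≡ f n

periodic-* : {A : Set} {f : ℕ → A} {m : ℕ} → Periodic f m → ∀ k → Periodic f (k * m)
periodic-* {f = f} {m} per zero    n = cong f (+-identityʳ n)
periodic-* {f = f} {m} per (suc k) n = begin
  f (n + (m + k * m)) ≡⟨ cong f (sym (+-assoc n m (k * m))) ⟩
  f (n + m + k * m)   ≡⟨ periodic-* per k (n + m) ⟩
  f (n + m)           ≡⟨ per n ⟩
  f n                 ∎
  where open ≡-Reasoning

module Arithmetic (p : ℕ) .{{_ : NonZero p}} where

  infixl 6 _+ₚ_
  _+ₚ_ : 𝔽 p → 𝔽 p → 𝔽 p
  _+ₚ_ = _⊕_ p

  0ₚ : 𝔽 p
  0ₚ = 𝟘 p

  toℕ-+ₚ : ∀ x y → toℕ (x +ₚ y) ≡ (toℕ x + toℕ y) % p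
  toℕ-+ₚ x y = toℕ-fromℕ< (m%n<n (toℕ x + toℕ y) p)

  toℕ-0ₚ : toℕ 0ₚ ≡ 0
  toℕ-0ₚ = trans (toℕ-fromℕ< (m%n<n 0 p)) (m<n⇒m%n≡m (>-nonZero⁻¹ p))

  toℕ%p : ∀ x → toℕ x % p ≡ toℕ x
  toℕ%p x = m<n⇒m%n≡m (toℕ<n x)

  +ₚ-comm : ∀ x y → x +ₚ y ≡ y +ₚ x
  +ₚ-comm x y = toℕ-injective (begin
    toℕ (x +ₚ y)          ≡⟨ toℕ-+ₚ x y ⟩
    (toℕ x + toℕ y) % p   ≡⟨ cong (_% p) (+-comm (toℕ x) (toℕ y)) ⟩
    (toℕ y + toℕ x) % p   ≡⟨ sym (toℕ-+ₚ y x) ⟩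
    toℕ (y +ₚ x)          ∎)
    where open ≡-Reasoning

  +ₚ-assoc : ∀ x y z → x +ₚ y +ₚ z ≡ x +ₚ (y +ₚ z)
  +ₚ-assoc x y z = toℕ-injective (begin
    toℕ (x +ₚ y +ₚ z)                    ≡⟨ toℕ-+ₚ (x +ₚ y) z ⟩
    (toℕ (x +ₚ y) + toℕ z) % p           ≡⟨ cong (λ k → (k + toℕ z) % p) (toℕ-+ₚ x y) ⟩
    ((toℕ x + toℕ y) % p + toℕ z) % p    ≡⟨ [m%d+n]%d≡[m+n]%d (toℕ x + toℕ y) (toℕ z) p ⟩
    (toℕ x + toℕ y + toℕ z) % p          ≡⟨ cong (_% p) (+-assoc (toℕ x) (toℕ y) (toℕ z)) ⟩
    (toℕ x + (toℕ y + toℕ z)) % p        ≡⟨ sym ([m+n%d]%d≡[m+n]%d (toℕ x) (toℕ y + toℕ z) p) ⟩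
    (toℕ x + (toℕ y + toℕ z) % p) % p    ≡⟨ cong (λ k → (toℕ x + k) % p) (sym (toℕ-+ₚ y z)) ⟩
    (toℕ x + toℕ (y +ₚ z)) % p           ≡⟨ sym (toℕ-+ₚ x (y +ₚ z)) ⟩
    toℕ (x +ₚ (y +ₚ z))                  ∎)
    where open ≡-Reasoning

  +ₚ-identityˡ : ∀ x → 0ₚ +ₚ x ≡ x
  +ₚ-identityˡ x = toℕ-injective (begin
    toℕ (0ₚ +ₚ x)          ≡⟨ toℕ-+ₚ 0ₚ x ⟩
    (toℕ 0ₚ + toℕ x) % p   ≡⟨ cong (λ k → (k + toℕ x) % p) toℕ-0ₚ ⟩
    toℕ x % p              ≡⟨ toℕ%p x ⟩
    toℕ x                  ∎)
    where open ≡-Reasoning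

  +ₚ-identityʳ : ∀ x → x +ₚ 0ₚ ≡ x
  +ₚ-identityʳ x = trans (+ₚ-comm x 0ₚ) (+ₚ-identityˡ x)

  x+ₚ[y+ₚz]≡y+ₚ[x+ₚz] : ∀ x y z → x +ₚ (y +ₚ z) ≡ y +ₚ (x +ₚ z)
  x+ₚ[y+ₚz]≡y+ₚ[x+ₚz] x y z = begin
    x +ₚ (y +ₚ z)  ≡⟨ sym (+ₚ-assoc x y z) ⟩
    x +ₚ y +ₚ z    ≡⟨ cong (_+ₚ z) (+ₚ-comm x y) ⟩
    y +ₚ x +ₚ z    ≡⟨ +ₚ-assoc y x z ⟩
    y +ₚ (x +ₚ z)  ∎
    where open ≡-Reasoning

  -ₚ_ : 𝔽 p → 𝔽 p
  -ₚ x = fromℕ< (m%n<n (p ∸ toℕ x) p)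

  +ₚ-inverseˡ : ∀ x → (-ₚ x) +ₚ x ≡ 0ₚ
  +ₚ-inverseˡ x = toℕ-injective (begin
    toℕ ((-ₚ x) +ₚ x)                  ≡⟨ toℕ-+ₚ (-ₚ x) x ⟩
    (toℕ (-ₚ x) + toℕ x) % p           ≡⟨ cong (λ k → (k + toℕ x) % p) (toℕ-fromℕ< (m%n<n (p ∸ toℕ x) p)) ⟩
    ((p ∸ toℕ x) % p + toℕ x) % p      ≡⟨ [m%d+n]%d≡[m+n]%d (p ∸ toℕ x) (toℕ x) p ⟩
    (p ∸ toℕ x + toℕ x) % p            ≡⟨ cong (_% p) (m∸n+n≡m (<⇒≤ (toℕ<n x))) ⟩
    p % p                              ≡⟨ n%n≡0 p ⟩
    0                                  ≡⟨ sym toℕ-0ₚ ⟩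
    toℕ 0ₚ                             ∎)
    where open ≡-Reasoning

  +ₚ-cancelˡ : ∀ x {y z} → x +ₚ y ≡ x +ₚ z → y ≡ z
  +ₚ-cancelˡ x {y} {z} eq = begin
    y                  ≡⟨ sym (+ₚ-identityˡ y) ⟩
    0ₚ +ₚ y            ≡⟨ cong (_+ₚ y) (sym (+ₚ-inverseˡ x)) ⟩
    (-ₚ x) +ₚ x +ₚ y   ≡⟨ +ₚ-assoc (-ₚ x) x y ⟩
    (-ₚ x) +ₚ (x +ₚ y) ≡⟨ cong ((-ₚ x) +ₚ_) eq ⟩
    (-ₚ x) +ₚ (x +ₚ z) ≡⟨ sym (+ₚ-assoc (-ₚ x) x z) ⟩
    (-ₚ x) +ₚ x +ₚ z   ≡⟨ cong (_+ₚ z) (+ₚ-inverseˡ x) ⟩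
    0ₚ +ₚ z            ≡⟨ +ₚ-identityˡ z ⟩
    z                  ∎
    where open ≡-Reasoning

  toℕ-fold-+ₚ : ∀ x y k → toℕ (fold y (x +ₚ_) k) ≡ (toℕ y + k * toℕ x) % p
  toℕ-fold-+ₚ x y zero = sym (trans (cong (_% p) (+-identityʳ (toℕ y))) (toℕ%p y))
  toℕ-fold-+ₚ x y (suc k) = begin
    toℕ (x +ₚ fold y (x +ₚ_) k)                  ≡⟨ toℕ-+ₚ x (fold y (x +ₚ_) k) ⟩
    (toℕ x + toℕ (fold y (x +ₚ_) k)) % p         ≡⟨ cong (λ n → (toℕ x + n) % p) (toℕ-fold-+ₚ x y k) ⟩
    (toℕ x + (toℕ y + k * toℕ x) % p) % p        ≡⟨ [m+n%d]%d≡[m+n]%d (toℕ x) (toℕ y + k * toℕ x) p ⟩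
    (toℕ x + (toℕ y + k * toℕ x)) % p            ≡⟨ cong (_% p) (x+[y+z]≡y+[x+z] (toℕ x) (toℕ y) (k * toℕ x)) ⟩
    (toℕ y + (toℕ x + k * toℕ x)) % p            ∎
    where
      open ≡-Reasoning
      x+[y+z]≡y+[x+z] : ∀ a b c → a + (b + c) ≡ b + (a + c)
      x+[y+z]≡y+[x+z] = solve-∀

  fold-+ₚ-p : ∀ x y → fold y (x +ₚ_) p ≡ y
  fold-+ₚ-p x y = toℕ-injective (begin
    toℕ (fold y (x +ₚ_) p)     ≡⟨ toℕ-fold-+ₚ x y p ⟩
    (toℕ y + p * toℕ x) % p    ≡⟨ cong (λ n → (toℕ y + n) % p) (*-comm p (toℕ x)) ⟩
    (toℕ y + toℕ x * p) % p    ≡⟨ [m+kn]%n≡m%n (toℕ y) (toℕ x) p ⟩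
    toℕ y % p                  ≡⟨ toℕ%p y ⟩
    toℕ y                      ∎)
    where open ≡-Reasoning

  x+ₚx≡0⇒x≡0 : Prime p → ¬ (2 ∣ p) → ∀ x → x +ₚ x ≡ 0ₚ → x ≡ 0ₚ
  x+ₚx≡0⇒x≡0 p-prime 2∤p x x+x≡0 with euclidsLemma 2 (toℕ x) p-prime p∣2x
    where
      p∣2x : p ∣ 2 * toℕ x
      p∣2x = m%n≡0⇒n∣m (2 * toℕ x) p (begin
        (2 * toℕ x) % p         ≡⟨ cong (λ n → (toℕ x + n) % p) (+-identityʳ (toℕ x)) ⟩
        (toℕ x + toℕ x) % p     ≡⟨ sym (toℕ-+ₚ x x) ⟩
        toℕ (x +ₚ x)            ≡⟨ cong toℕ x+x≡0 ⟩
        toℕ 0ₚ                  ≡⟨ toℕ-0ₚ ⟩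
        0                       ∎)
        where open ≡-Reasoning
  ... | inj₁ p∣2 = ⊥-elim (2∤p (subst (2 ∣_) (sym p≡2) ∣-refl))
    where
      p≡2 : p ≡ 2
      p≡2 = ≤-antisym (∣⇒≤ p∣2) (nonTrivial⇒n>1 p {{prime⇒nonTrivial p-prime}})
  ... | inj₂ p∣x = toℕ-injective (begin
    toℕ x      ≡⟨ sym (toℕ%p x) ⟩
    toℕ x % p  ≡⟨ n∣m⇒m%n≡0 (toℕ x) p p∣x ⟩
    0          ≡⟨ sym toℕ-0ₚ ⟩
    toℕ 0ₚ     ∎)
    where open ≡-Reasoning

module Substitution (p : ℕ) .{{_ : NonZero p}} where

  open Arithmetic p

  τˡ τʳ : Tile p → Tile p
  τˡ (x , y) = x , x +ₚ y
  τʳ (x , y) = x +ₚ y , y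

  _⌢_ : Tile p → Tile p → Set
  v ⌢ w = proj₂ v ≡ proj₁ w

  Matched : (ℕ → Tile p) → Set
  Matched w = ∀ n → w n ⌢ w (suc n)

  record IsImage (v w : ℕ → Tile p) : Set where
    field
      at-even : ∀ n → v (2 * n) ≡ τˡ (w n)
      at-odd  : ∀ n → v (suc (2 * n)) ≡ τʳ (w n)

  module _ {v w : ℕ → Tile p} (image : IsImage v w) where

    open IsImage image

    periodic-image-halves : ∀ {m} → Periodic v (2 * m) → Periodic w m
    periodic-image-halves {m} per n = cong₂ _,_ (cong proj₁ τˡ-eq) (cong proj₂ τʳ-eq)
      where
        open ≡-Reasoning
        τˡ-eq : τˡ (w (n + m)) ≡ τˡ (w n)
        τˡ-eq = begin
          τˡ (w (n + m))     ≡⟨ sym (at-even (n + m)) ⟩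
          v (2 * (n + m))    ≡⟨ cong v (*-distribˡ-+ 2 n m) ⟩
          v (2 * n + 2 * m)  ≡⟨ per (2 * n) ⟩
          v (2 * n)          ≡⟨ at-even n ⟩
          τˡ (w n)           ∎
        τʳ-eq : τʳ (w (n + m)) ≡ τʳ (w n)
        τʳ-eq = begin
          τʳ (w (n + m))          ≡⟨ sym (at-odd (n + m)) ⟩
          v (suc (2 * (n + m)))   ≡⟨ cong (v ∘ suc) (*-distribˡ-+ 2 n m) ⟩
          v (suc (2 * n + 2 * m)) ≡⟨ per (suc (2 * n)) ⟩
          v (suc (2 * n))         ≡⟨ at-odd n ⟩
          τʳ (w n)                ∎

    periodic-image⇒periodic : ∀ {m} → Periodic v m → Periodic w m
    periodic-image⇒periodic per = periodic-image-halves (periodic-* per 2)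

    module OddPeriod (matched : Matched w) (h : ℕ) (per : Periodic v (suc (2 * h))) where

      c : ℕ → 𝔽 p
      c n = proj₁ (w n)

      left-even : ∀ n → proj₁ (v (2 * n)) ≡ c n
      left-even n = cong proj₁ (at-even n)

      left-odd : ∀ n → proj₁ (v (suc (2 * n))) ≡ c n +ₚ c (suc n)
      left-odd n = trans (cong proj₁ (at-odd n)) (cong (c n +ₚ_) (matched n))

      c[n+h]+ₚc[1+n+h]≡c[n] : ∀ n → c (n + h) +ₚ c (suc (n + h)) ≡ c n
      c[n+h]+ₚc[1+n+h]≡c[n] n = begin
        c (n + h) +ₚ c (suc (n + h))     ≡⟨ sym (left-odd (n + h)) ⟩
        proj₁ (v (suc (2 * (n + h))))    ≡⟨ cong (proj₁ ∘ v) (index n h) ⟩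
        proj₁ (v (2 * n + suc (2 * h)))  ≡⟨ cong proj₁ (per (2 * n)) ⟩
        proj₁ (v (2 * n))                ≡⟨ left-even n ⟩
        c n                              ∎
        where
          open ≡-Reasoning
          index : ∀ n h → suc (2 * (n + h)) ≡ 2 * n + suc (2 * h)
          index = solve-∀

      c[1+n+h]≡c[n]+ₚc[1+n] : ∀ n → c (suc (n + h)) ≡ c n +ₚ c (suc n)
      c[1+n+h]≡c[n]+ₚc[1+n] n = begin
        c (suc (n + h))                        ≡⟨ sym (left-even (suc (n + h))) ⟩
        proj₁ (v (2 * suc (n + h)))            ≡⟨ cong (proj₁ ∘ v) (index n h) ⟩
        proj₁ (v (suc (2 * n) + suc (2 * h)))  ≡⟨ cong proj₁ (per (suc (2 * n))) ⟩
        proj₁ (v (suc (2 * n)))                ≡⟨ left-odd n ⟩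
        c n +ₚ c (suc n)                       ∎
        where
          open ≡-Reasoning
          index : ∀ n h → 2 * suc (n + h) ≡ suc (2 * n) + suc (2 * h)
          index = solve-∀

      c[n+h]+ₚc[1+n]≡0 : ∀ n → c (n + h) +ₚ c (suc n) ≡ 0ₚ
      c[n+h]+ₚc[1+n]≡0 n = +ₚ-cancelˡ (c n) (begin
        c n +ₚ (c (n + h) +ₚ c (suc n))  ≡⟨ x+ₚ[y+ₚz]≡y+ₚ[x+ₚz] (c n) (c (n + h)) (c (suc n)) ⟩
        c (n + h) +ₚ (c n +ₚ c (suc n))  ≡⟨ cong (c (n + h) +ₚ_) (sym (c[1+n+h]≡c[n]+ₚc[1+n] n)) ⟩
        c (n + h) +ₚ c (suc (n + h))     ≡⟨ c[n+h]+ₚc[1+n+h]≡c[n] n ⟩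
        c n                              ≡⟨ sym (+ₚ-identityʳ (c n)) ⟩
        c n +ₚ 0ₚ                        ∎)
        where open ≡-Reasoning

      c[n]+ₚc[1+n]+ₚc[2+n]≡0 : ∀ n → c n +ₚ c (1 + n) +ₚ c (2 + n) ≡ 0ₚ
      c[n]+ₚc[1+n]+ₚc[2+n]≡0 n =
        trans (cong (_+ₚ c (2 + n)) (sym (c[1+n+h]≡c[n]+ₚc[1+n] n))) (c[n+h]+ₚc[1+n]≡0 (suc n))

      c-periodic : Periodic c 3
      c-periodic n = trans (cong c (+-comm n 3)) (+ₚ-cancelˡ X (begin
        X +ₚ c (3 + n)                 ≡⟨ c[n]+ₚc[1+n]+ₚc[2+n]≡0 (suc n) ⟩
        0ₚ                             ≡⟨ sym (c[n]+ₚc[1+n]+ₚc[2+n]≡0 n) ⟩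
        c n +ₚ c (1 + n) +ₚ c (2 + n)  ≡⟨ +ₚ-assoc (c n) (c (1 + n)) (c (2 + n)) ⟩
        c n +ₚ X                       ≡⟨ +ₚ-comm (c n) X ⟩
        X +ₚ c n                       ∎))
        where
          open ≡-Reasoning
          X = c (1 + n) +ₚ c (2 + n)

    -- With the period 3m the shift h becomes ≡ 1 mod 3, so by 3-periodicity of c the
    -- relation c(n + h) + c(n + 1) = 0 reads 2·c(n + 1) = 0.
    odd-period⇒start≡0 : Prime p → ¬ (2 ∣ p) → Matched w →
                         ∀ h → Periodic v (suc (2 * h)) → w 0 ≡ (0ₚ , 0ₚ)
    odd-period⇒start≡0 p-prime 2∤p matched h per =
      cong₂ _,_ c[0]≡0 (trans (matched 0) (c[1+n]≡0 0))
      where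
        index : ∀ h → 3 * suc (2 * h) ≡ suc (2 * suc (3 * h))
        index = solve-∀
        open OddPeriod matched (suc (3 * h)) (subst (Periodic v) (index h) (periodic-* per 3))
        c[1+n]≡0 : ∀ n → c (suc n) ≡ 0ₚ
        c[1+n]≡0 n = x+ₚx≡0⇒x≡0 p-prime 2∤p (c (suc n))
          (trans (cong (_+ₚ c (suc n)) (sym c[n+h′]≡c[1+n])) (c[n+h]+ₚc[1+n]≡0 n))
          where
            index′ : ∀ n h → n + suc (3 * h) ≡ suc n + h * 3
            index′ = solve-∀
            c[n+h′]≡c[1+n] : c (n + suc (3 * h)) ≡ c (suc n)
            c[n+h′]≡c[1+n] = trans (cong c (index′ n h)) (periodic-* c-periodic h (suc n))
        c[0]≡0 : c 0 ≡ 0ₚ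
        c[0]≡0 = trans (sym (c-periodic 0)) (c[1+n]≡0 2)

  length-τ : ∀ L → length (τ p L) ≡ 2 * length L
  length-τ []      = refl
  length-τ (w ∷ L) = trans (cong (suc ∘ suc) (length-τ L)) (sym (*-suc 2 (length L)))

  length-τ^ : ∀ K L → length (τ^ p K L) ≡ 2 ^ K * length L
  length-τ^ zero    L = sym (*-identityˡ (length L))
  length-τ^ (suc K) L = begin
    length (τ p (τ^ p K L))  ≡⟨ length-τ (τ^ p K L) ⟩
    2 * length (τ^ p K L)    ≡⟨ cong (2 *_) (length-τ^ K L) ⟩
    2 * (2 ^ K * length L)   ≡⟨ sym (*-assoc 2 (2 ^ K) (length L)) ⟩
    2 ^ suc K * length L     ∎
    where open ≡-Reasoning

  τ^-+ : ∀ k j L → τ^ p (k + j) L ≡ τ^ p k (τ^ p j L)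
  τ^-+ zero    j L = refl
  τ^-+ (suc k) j L = cong (τ p) (τ^-+ k j L)

  τ^-++ : ∀ k L M → τ^ p k (L ++ M) ≡ τ^ p k L ++ τ^ p k M
  τ^-++ zero    L M = refl
  τ^-++ (suc k) L M = trans (cong (τ p) (τ^-++ k L M)) (concatMap-++ (τ₁ p) (τ^ p k L) (τ^ p k M))

  nth-++ˡ : ∀ d L M {n} → n < length L → nth p d (L ++ M) n ≡ nth p d L n
  nth-++ˡ d (w ∷ L) M {zero}  _         = refl
  nth-++ˡ d (w ∷ L) M {suc n} (s≤s n<l) = nth-++ˡ d L M n<l

  nth-τ-even : ∀ d L {n} → n < length L → nth p d (τ p L) (2 * n) ≡ τˡ (nth p d L n)
  nth-τ-even d (w ∷ L) {zero}  _ = refl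
  nth-τ-even d (w ∷ L) {suc n} (s≤s n<l) =
    trans (cong (nth p d (τ p (w ∷ L))) (*-suc 2 n)) (nth-τ-even d L n<l)

  nth-τ-odd : ∀ d L {n} → n < length L → nth p d (τ p L) (suc (2 * n)) ≡ τʳ (nth p d L n)
  nth-τ-odd d (w ∷ L) {zero}  _ = refl
  nth-τ-odd d (w ∷ L) {suc n} (s≤s n<l) =
    trans (cong (nth p d (τ p (w ∷ L)) ∘ suc) (*-suc 2 n)) (nth-τ-odd d L n<l)

  τ-linked : ∀ {L} → Linked _⌢_ L → Linked _⌢_ (τ p L)
  τ-linked []              = []
  τ-linked [-]             = refl ∷ [-]
  τ-linked (w⌢w′ ∷ linked) = refl ∷ w⌢w′ ∷ τ-linked linked

  nth-linked : ∀ d {L} → Linked _⌢_ L → ∀ {n} → suc n < length L → nth p d L n ⌢ nth p d L (suc n)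
  nth-linked d [-]          {_}     (s≤s ())
  nth-linked d (w⌢w′ ∷ _)   {zero}  _           = w⌢w′
  nth-linked d (_ ∷ linked) {suc n} (s≤s 1+n<l) = nth-linked d linked 1+n<l

module Tiling (q : ℕ) (t : Tile (suc q)) where

  p : ℕ
  p = suc q

  open Arithmetic p
  open Substitution p

  approx : ℕ → ℕ → Tile p
  approx K = nth p t (τ^ p K (t ∷ []))

  <2^⇒<length : ∀ K {n} → n < 2 ^ K → n < length (τ^ p K (t ∷ []))
  <2^⇒<length K = subst (_ <_) (sym (trans (length-τ^ K (t ∷ [])) (*-identityʳ (2 ^ K))))

  approx-even : ∀ K {n} → n < 2 ^ K → approx (suc K) (2 * n) ≡ τˡ (approx K n)
  approx-even K n<2^K = nth-τ-even t (τ^ p K (t ∷ [])) (<2^⇒<length K n<2^K)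

  approx-odd : ∀ K {n} → n < 2 ^ K → approx (suc K) (suc (2 * n)) ≡ τʳ (approx K n)
  approx-odd K n<2^K = nth-τ-odd t (τ^ p K (t ∷ [])) (<2^⇒<length K n<2^K)

  τ^-linked : ∀ K → Linked _⌢_ (τ^ p K (t ∷ []))
  τ^-linked zero    = [-]
  τ^-linked (suc K) = τ-linked (τ^-linked K)

  approx-matched : ∀ K {n} → suc n < 2 ^ K → approx K n ⌢ approx K (suc n)
  approx-matched K 1+n<2^K = nth-linked t (τ^-linked K) (<2^⇒<length K 1+n<2^K)

  approx-0 : ∀ K → approx K 0 ≡ (proj₁ t , fold (proj₂ t) (proj₁ t +ₚ_) K)
  approx-0 zero    = refl
  approx-0 (suc K) = trans (approx-even K (m^n>0 2 K)) (cong τˡ (approx-0 K))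

  approx-p-0 : approx p 0 ≡ t
  approx-p-0 = trans (approx-0 p) (cong (proj₁ t ,_) (fold-+ₚ-p (proj₁ t) (proj₂ t)))

  τ^p[t]-head : ∃ λ rest → τ^ p p (t ∷ []) ≡ t ∷ rest
  τ^p[t]-head = starts-with-t (τ^ p p (t ∷ [])) (<2^⇒<length p (m^n>0 2 p)) approx-p-0
    where
      starts-with-t : ∀ L → 0 < length L → nth p t L 0 ≡ t → ∃ λ rest → L ≡ t ∷ rest
      starts-with-t (w ∷ L) _ refl = L , refl

  approx-+p : ∀ K {n} → n < 2 ^ K → approx (K + p) n ≡ approx K n
  approx-+p K {n} n<2^K with τ^p[t]-head
  ... | rest , τ^p[t]≡t∷rest = begin
    nth p t (τ^ p (K + p) (t ∷ [])) n           ≡⟨ cong (λ L → nth p t L n) (τ^-+ K p (t ∷ [])) ⟩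
    nth p t (τ^ p K (τ^ p p (t ∷ []))) n        ≡⟨ cong (λ L → nth p t (τ^ p K L) n) τ^p[t]≡t∷rest ⟩
    nth p t (τ^ p K ((t ∷ []) ++ rest)) n       ≡⟨ cong (λ L → nth p t L n) (τ^-++ K (t ∷ []) rest) ⟩
    nth p t (τ^ p K (t ∷ []) ++ τ^ p K rest) n  ≡⟨ nth-++ˡ t (τ^ p K (t ∷ [])) (τ^ p K rest) (<2^⇒<length K n<2^K) ⟩
    approx K n                                  ∎
    where open ≡-Reasoning

  approx-+*p : ∀ K {n} → n < 2 ^ K → ∀ i → approx (K + i * p) n ≡ approx K n
  approx-+*p K {n} n<2^K zero    = cong (λ k → approx k n) (+-identityʳ K)
  approx-+*p K {n} n<2^K (suc i) = begin
    approx (K + (p + i * p)) n  ≡⟨ cong (λ k → approx k n) (sym (+-assoc K p (i * p))) ⟩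
    approx (K + p + i * p) n    ≡⟨ approx-+*p (K + p) (<-≤-trans n<2^K (^-monoʳ-≤ 2 (m≤m+n K p))) i ⟩
    approx (K + p) n            ≡⟨ approx-+p K n<2^K ⟩
    approx K n                  ∎
    where open ≡-Reasoning

  -- Wτ j is τʲ(W_t): its n-th tile is read off τ^K(t) for K = j + (n+1)p, which is
  -- ≡ j mod p and large enough (2^K > n) for that tile to have stabilised.
  Wτ : ℕ → ℕ → Tile p
  Wτ j n = approx (j + suc n * p) n

  ≤⇒<2^[j+i*p] : ∀ j {n i} → n ≤ i → n < 2 ^ (j + i * p)
  ≤⇒<2^[j+i*p] j {n} {i} n≤i =
    <-≤-trans (n<2^n n) (^-monoʳ-≤ 2 (≤-trans n≤i (≤-trans (m≤m*n i p) (m≤n+m (i * p) j))))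

  Wτ≡approx : ∀ j {n} i → n < 2 ^ (j + i * p) → Wτ j n ≡ approx (j + i * p) n
  Wτ≡approx j {n} i n<2^K = begin
    approx (j + suc n * p) n            ≡⟨ sym (approx-+*p (j + suc n * p) (≤⇒<2^[j+i*p] j (n≤1+n n)) i) ⟩
    approx (j + suc n * p + i * p) n    ≡⟨ cong (λ k → approx k n) (a+b+c≡a+c+b j (suc n * p) (i * p)) ⟩
    approx (j + i * p + suc n * p) n    ≡⟨ approx-+*p (j + i * p) n<2^K (suc n) ⟩
    approx (j + i * p) n                ∎
    where
      open ≡-Reasoning
      a+b+c≡a+c+b : ∀ a b c → a + b + c ≡ a + c + b
      a+b+c≡a+c+b = solve-∀

  Wτ-image : ∀ j → IsImage (Wτ (suc j)) (Wτ j)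
  Wτ-image j = record { at-even = at-even ; at-odd = at-odd }
    where
      open ≡-Reasoning
      at-even : ∀ n → Wτ (suc j) (2 * n) ≡ τˡ (Wτ j n)
      at-even n = begin
        Wτ (suc j) (2 * n)                ≡⟨ Wτ≡approx (suc j) i (≤⇒<2^[j+i*p] (suc j) (n≤1+n (2 * n))) ⟩
        approx (suc (j + i * p)) (2 * n)  ≡⟨ approx-even (j + i * p) n<2^K ⟩
        τˡ (approx (j + i * p) n)         ≡⟨ cong τˡ (sym (Wτ≡approx j i n<2^K)) ⟩
        τˡ (Wτ j n)                       ∎
        where
          i = suc (2 * n)
          n<2^K = ≤⇒<2^[j+i*p] j (≤-trans (m≤n*m n 2) (n≤1+n (2 * n)))
      at-odd : ∀ n → Wτ (suc j) (suc (2 * n)) ≡ τʳ (Wτ j n)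
      at-odd n = begin
        Wτ (suc j) (suc (2 * n))                ≡⟨ Wτ≡approx (suc j) i (≤⇒<2^[j+i*p] (suc j) ≤-refl) ⟩
        approx (suc (j + i * p)) (suc (2 * n))  ≡⟨ approx-odd (j + i * p) n<2^K ⟩
        τʳ (approx (j + i * p) n)               ≡⟨ cong τʳ (sym (Wτ≡approx j i n<2^K)) ⟩
        τʳ (Wτ j n)                             ∎
        where
          i = suc (2 * n)
          n<2^K = ≤⇒<2^[j+i*p] j (≤-trans (m≤n*m n 2) (n≤1+n (2 * n)))

  Wτ-matched : ∀ j → Matched (Wτ j)
  Wτ-matched j n = subst₂ _⌢_ (sym (Wτ≡approx j i n<2^K)) (sym (Wτ≡approx j i 1+n<2^K))
                     (approx-matched (j + i * p) 1+n<2^K)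
    where
      i = suc n
      n<2^K = ≤⇒<2^[j+i*p] j (n≤1+n n)
      1+n<2^K = ≤⇒<2^[j+i*p] j ≤-refl

  Wτ-+p : ∀ j n → Wτ (j + p) n ≡ Wτ j n
  Wτ-+p j n = trans (cong (λ k → approx k n) (+-assoc j p (suc n * p)))
                    (sym (Wτ≡approx j (suc (suc n)) (≤⇒<2^[j+i*p] j (≤-trans (n≤1+n n) (n≤1+n (suc n))))))

  Wτ-0-0 : Wτ 0 0 ≡ t
  Wτ-0-0 = trans (cong (λ k → approx k 0) (+-identityʳ p)) approx-p-0

module Aperiodicity (q : ℕ) (p-prime : Prime (suc q)) (2∤p : ¬ (2 ∣ suc q))
                    (t : Tile (suc q)) (t≢0 : ¬ (t ≡ (𝟘 (suc q) , 𝟘 (suc q)))) where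

  open Tiling q t
  open Arithmetic p
  open Substitution p

  periodic-Wτ⇒periodic-Wτ₀ : ∀ j {m} → Periodic (Wτ j) m → Periodic (Wτ 0) m
  periodic-Wτ⇒periodic-Wτ₀ zero    per = per
  periodic-Wτ⇒periodic-Wτ₀ (suc j) per =
    periodic-Wτ⇒periodic-Wτ₀ j (periodic-image⇒periodic (Wτ-image j) per)

  periodic-Wτₚ : ∀ {m} → Periodic (Wτ 0) m → Periodic (Wτ p) m
  periodic-Wτₚ {m} per n = trans (Wτ-+p 0 (n + m)) (trans (per n) (sym (Wτ-+p 0 n)))

  aperiodic : ∀ m → Acc _<_ m → 0 < m → ¬ Periodic (Wτ 0) m
  aperiodic m (acc smaller) 0<m per with evenOrOdd m
  ... | even zero    = <-irrefl refl 0<m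
  ... | even (suc k) = aperiodic (suc k) (smaller (m<m+n (suc k) z<s)) z<s
    (periodic-Wτ⇒periodic-Wτ₀ q (periodic-image-halves (Wτ-image q) (periodic-Wτₚ per)))
  ... | odd h        = t≢0 (begin
    t                ≡⟨ sym Wτ-0-0 ⟩
    Wτ 0 0           ≡⟨ sym (Wτ-+p 0 0) ⟩
    Wτ p 0           ≡⟨ IsImage.at-even (Wτ-image q) 0 ⟩
    τˡ (Wτ q 0)      ≡⟨ cong τˡ (odd-period⇒start≡0 (Wτ-image q) p-prime 2∤p (Wτ-matched q) h (periodic-Wτₚ per)) ⟩
    τˡ (0ₚ , 0ₚ)     ≡⟨ cong (0ₚ ,_) (+ₚ-identityˡ 0ₚ) ⟩
    (0ₚ , 0ₚ)        ∎)
    where open ≡-Reasoning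

mainTheorem20 : (p : ℕ) .{{_ : NonZero p}} → Prime p → ¬ (2 ∣ p) →
    (t : Tile p) → ¬ (t ≡ (𝟘 p , 𝟘 p)) →
    ¬ (Σ ℕ (λ m → (0 < m) × ((n : ℕ) → W p t (n + m) ≡ W p t n)))
mainTheorem20 zero    p-prime _   _ _   _               = NonZero.nonZero (prime⇒nonZero p-prime)
mainTheorem20 (suc q) p-prime 2∤p t t≢0 (m , 0<m , per) =
  Aperiodicity.aperiodic q p-prime 2∤p t t≢0 m (<-wellFounded m) 0<m per
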